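{- Let $G$ be a connected strongly regular graph with parameters $(n,k,a,c)$ which is not complete and has $k\ge 3$. Suppose a terminating chip-firing game with $N$ chips was played on $G$ and let $s$ be the total number of firings. Then $$ s \leq n\frac{k-1}{k-2}+\frac{2(2N-k+1)}{c}.$$
   Context: A strongly regular graph with parameters $(n,k,a,c)$ is a $k$-regular simple graph on $n$ vertices such that any two adjacent vertices have exactly $a$ common neighbours and any two distinct non-adjacent vertices have exactly $c$ common neighbours; connectedness of a non-complete such graph gives $c\ge1$. Chip-firing game: a configuration is a vector $\mathbf a\in\mathbb Z_{\ge 0}^n$ ($a_i$ chips on vertex $i$), with $N=\sum_i a_i$ chips. Vertex $i$ may fire if $a_i\ge k$; firing moves one chip from $i$ to each neighbour of $i$. A terminating game is a finite sequence of legal firings from an initial configuration ending in a configuration in which no vertex can fire; $s$ is the length of this sequence. -}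

module Defs where

open import Data.Nat using (ℕ; zero; suc; _+_; _∸_; _<_; _≤_)
open import Data.Fin using (Fin; zero; suc)
open import Data.Bool using (Bool; true; false; T; if_then_else_; _∧_)
open import Data.Product using (Σ; ∃; _×_; _,_)
open import Relation.Binary.PropositionalEquality using (_≡_)
open import Relation.Nullary using (¬_)
open import Data.Fin using (_≟_)
open import Relation.Nullary.Decidable using (⌊_⌋)

count : {n : ℕ} → (Fin n → Bool) → ℕ
count {zero}  p = 0
count {suc n} p = (if p zero then 1 else 0) + count (λ i → p (suc i))

total : {n : ℕ} → (Fin n → ℕ) → ℕ
total {zero}  a = 0
total {suc n} a = a zero + total (λ i → a (suc i))

record Graph (n : ℕ) : Set where
  field
    adj     : Fin n → Fin n → Bool
    adj-sym : ∀ i j → adj i j ≡ adj j i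
    irrefl  : ∀ i → adj i i ≡ false
open Graph public

degree : {n : ℕ} → Graph n → Fin n → ℕ
degree G i = count (λ j → adj G i j)

commonNbrs : {n : ℕ} → Graph n → Fin n → Fin n → ℕ
commonNbrs G i j = count (λ l → adj G i l ∧ adj G j l)

data Walk {n : ℕ} (G : Graph n) : Fin n → Fin n → Set where
  here : ∀ {i} → Walk G i i
  step : ∀ {i j l} → T (adj G i j) → Walk G j l → Walk G i l

Connected : {n : ℕ} → Graph n → Set
Connected G = ∀ i j → Walk G i j

Complete : {n : ℕ} → Graph n → Set
Complete G = ∀ i j → ¬ (i ≡ j) → T (adj G i j)

IsSRG : (n : ℕ) → Graph n → (k a c : ℕ) → Set
IsSRG n G k a c =
  (∀ i → degree G i ≡ k) ×
  (∀ i j → T (adj G i j) → commonNbrs G i j ≡ a) ×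
  (∀ i j → ¬ (i ≡ j) → ¬ T (adj G i j) → commonNbrs G i j ≡ c)

Config : ℕ → Set
Config n = Fin n → ℕ

fire : {n : ℕ} → Graph n → Config n → Fin n → Config n
fire G a v u =
  if ⌊ u ≟ v ⌋ then a u ∸ degree G v
  else (if adj G u v then suc (a u) else a u)

CanFire : {n : ℕ} → Graph n → Config n → Fin n → Set
CanFire G a v = degree G v ≤ a v

data Game {n : ℕ} (G : Graph n) : Config n → Config n → ℕ → Set where
  done : ∀ {a} → Game G a a 0
  fires : ∀ {a b s} v → CanFire G a v → Game G (fire G a v) b s → Game G a b (suc s)

Stable : {n : ℕ} → Graph n → Config n → Set
Stable G b = ∀ v → b v < degree G v

TerminatingGame : {n : ℕ} → Graph n → Config n → ℕ → Set
TerminatingGame G a s = Σ (Config _) (λ b → Game G a b s × Stable G b)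

module Submission where

-- Let x be the firing vector, A the adjacency matrix and Σ x = s.
--  * Balance: at every vertex u, final chips + k·x(u) = initial chips + (A x)(u). Since A is
--    symmetric, summing over u shows that the number of chips is conserved.
--  * If every vertex fired, the end configuration would not be stable; so some u has x(u) = 0.
--  * Strong regularity counts walks of length two:
--      (A² x)(u) + c·(A x)(u) + c·x(u) = k·x(u) + a·(A x)(u) + c·Σ x;
--    at the all-ones vector this is the parameter relation k(k − a − 1) = c(n − k − 1).
--  * At the unfired u, with X = (A x)(u) < k the chips it received and B the final chips on its
--    neighbours (B + X ≤ N), the balance over the neighbourhood of u gives c·s + a·X ≤ B + (k + c)·X.
--  * Connectivity and non-completeness give c ≥ 1 and a ≤ k − 2, and arithmetic finishes.

open import Defs
open import Data.Nat using (ℕ; _≤_; _∸_; _*_)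
open import Relation.Nullary using (¬_)
open import Relation.Binary.PropositionalEquality using (_≡_)

open import Data.Nat using (zero; suc; z≤n; s≤s; _<_; _≤?_)
open import Data.Nat.Properties hiding (_≟_)
open import Data.Nat.Tactic.RingSolver using (solve-∀)
open import Data.Fin using (Fin; zero; suc; _≟_)
open import Data.Fin.Properties using (punchInᵢ≢i; ¬∀⟶∃¬; all?)
open import Data.Bool using (Bool; true; false; T; if_then_else_; _∧_)
open import Data.Bool.Properties using (∧-idem)
open import Data.Empty using (⊥-elim)
open import Data.Unit using (tt)
open import Data.Product using (Σ; _×_; _,_; proj₁; proj₂)
open import Data.Sum using (_⊎_; inj₁; inj₂)
open import Function using (_∘_)
open import Relation.Nullary using (Dec; yes; no; contradiction)
open import Relation.Nullary.Decidable using (⌊_⌋; isYes≗does; dec-true; dec-false; ¬?; _→-dec_; T?)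
open import Relation.Binary.PropositionalEquality
  using (_≢_; refl; sym; trans; cong; cong₂; subst; module ≡-Reasoning)

module FiniteSums where
  open import Data.Nat using (_+_)
  open import Algebra.Properties.Semiring.Sum +-*-semiring public
    using (sum; sum-syntax; ∑-distrib-+; ∑-comm; *-distribˡ-sum; sum-cong-≗; sum-replicate-zero)
  open import Algebra.Properties.Semiring.Sum +-*-semiring using (sum-remove)
  open import Data.Vec.Functional using (removeAt)

  𝟙 : Bool → ℕ
  𝟙 b = if b then 1 else 0

  T⇒𝟙≡1 : ∀ {b} → T b → 𝟙 b ≡ 1
  T⇒𝟙≡1 {true} _ = refl

  ¬T⇒𝟙≡0 : ∀ {b} → ¬ T b → 𝟙 b ≡ 0
  ¬T⇒𝟙≡0 {true}  ¬t = ⊥-elim (¬t tt)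
  ¬T⇒𝟙≡0 {false} _  = refl

  𝟙≤1 : ∀ b → 𝟙 b ≤ 1
  𝟙≤1 true  = ≤-refl
  𝟙≤1 false = z≤n

  𝟙-∧ : ∀ b b′ → 𝟙 (b ∧ b′) ≡ 𝟙 b′ * 𝟙 b
  𝟙-∧ true  b′ = sym (*-identityʳ (𝟙 b′))
  𝟙-∧ false b′ = sym (*-zeroʳ (𝟙 b′))

  total≡sum : ∀ {n} (f : Fin n → ℕ) → total f ≡ sum f
  total≡sum {zero}  f = refl
  total≡sum {suc n} f = cong (f zero +_) (total≡sum (f ∘ suc))

  count≡sum : ∀ {n} (p : Fin n → Bool) → count p ≡ ∑[ i < n ] 𝟙 (p i)
  count≡sum {zero}  p = refl
  count≡sum {suc n} p = cong (𝟙 (p zero) +_) (count≡sum (p ∘ suc))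

  sum-ones : ∀ n → ∑[ i < n ] 1 ≡ n
  sum-ones zero    = refl
  sum-ones (suc n) = cong suc (sum-ones n)

  sum-linear : ∀ {n} p q r (f g h : Fin n → ℕ) →
               ∑[ z < n ] (p * f z + q * g z + r * h z) ≡ p * sum f + q * sum g + r * sum h
  sum-linear p q r f g h = begin
    ∑[ z < _ ] (p * f z + q * g z + r * h z)
      ≡⟨ ∑-distrib-+ (λ z → p * f z + q * g z) (λ z → r * h z) ⟩
    ∑[ z < _ ] (p * f z + q * g z) + ∑[ z < _ ] (r * h z)
      ≡⟨ cong (_+ ∑[ z < _ ] (r * h z)) (∑-distrib-+ (λ z → p * f z) (λ z → q * g z)) ⟩
    ∑[ z < _ ] (p * f z) + ∑[ z < _ ] (q * g z) + ∑[ z < _ ] (r * h z)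
      ≡⟨ cong₂ _+_ (cong₂ _+_ (*-distribˡ-sum p f) (*-distribˡ-sum q g)) (*-distribˡ-sum r h) ⟨
    p * sum f + q * sum g + r * sum h
      ∎
    where open ≡-Reasoning

  sum-mono : ∀ {n} {f g : Fin n → ℕ} → (∀ i → f i ≤ g i) → sum f ≤ sum g
  sum-mono {zero}  f≤g = z≤n
  sum-mono {suc n} f≤g = +-mono-≤ (f≤g zero) (sum-mono (f≤g ∘ suc))

  term≤sum : ∀ {n} (f : Fin n → ℕ) (v : Fin n) → f v ≤ sum f
  term≤sum {suc n} f v rewrite sum-remove {i = v} f = m≤m+n (f v) (sum (removeAt f v))

  sum-point : ∀ {n} (f : Fin n → ℕ) (v : Fin n) → (∀ w → w ≢ v → f w ≡ 0) → sum f ≡ f v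
  sum-point {suc n} f v vanish = begin
    sum f                     ≡⟨ sum-remove {i = v} f ⟩
    f v + sum (removeAt f v)  ≡⟨ cong (f v +_) (sum-cong-≗ (λ j → vanish _ (punchInᵢ≢i v j))) ⟩
    f v + ∑[ j < n ] 0        ≡⟨ cong (f v +_) (sum-replicate-zero n) ⟩
    f v + 0                   ≡⟨ +-identityʳ (f v) ⟩
    f v                       ∎
    where open ≡-Reasoning

  zeroOrPositive : ∀ {n} (f : Fin n → ℕ) → Σ (Fin n) (λ u → f u ≡ 0) ⊎ (∀ u → 1 ≤ f u)
  zeroOrPositive f with all? (λ u → 1 ≤? f u)
  ... | yes positive = inj₂ positive
  ... | no ¬positive with ¬∀⟶∃¬ _ _ (λ u → 1 ≤? f u) ¬positive
  ...   | u , ¬positive-u = inj₁ (u , n<1⇒n≡0 (≰⇒> ¬positive-u))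

  unit : ∀ {n} → Fin n → Fin n → ℕ
  unit v w = 𝟙 ⌊ w ≟ v ⌋

  unit-self : ∀ {n} (v : Fin n) → unit v v ≡ 1
  unit-self v = cong 𝟙 (trans (isYes≗does (v ≟ v)) (dec-true (v ≟ v) refl))

  unit-other : ∀ {n} {v w : Fin n} → w ≢ v → unit v w ≡ 0
  unit-other {v = v} {w} w≢v = cong 𝟙 (trans (isYes≗does (w ≟ v)) (dec-false (w ≟ v) w≢v))

  sum-unit-1 : ∀ {n} (v : Fin n) → ∑[ w < n ] unit v w ≡ 1
  sum-unit-1 v = trans (sum-point (unit v) v (λ w → unit-other)) (unit-self v)

  sum-unit : ∀ {n} (v : Fin n) (f : Fin n → ℕ) → ∑[ w < n ] (unit v w * f w) ≡ f v
  sum-unit v f = begin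
    ∑[ w < _ ] (unit v w * f w) ≡⟨ sum-point _ v (λ w w≢v → cong (_* f w) (unit-other w≢v)) ⟩
    unit v v * f v             ≡⟨ cong (_* f v) (unit-self v) ⟩
    1 * f v                    ≡⟨ *-identityˡ (f v) ⟩
    f v                        ∎
    where open ≡-Reasoning

module Graphs {n : ℕ} (G : Graph n) where
  open import Data.Nat using (_+_)
  open FiniteSums

  edge : Fin n → Fin n → ℕ
  edge u w = 𝟙 (adj G u w)

  edge-sym : ∀ u w → edge u w ≡ edge w u
  edge-sym u w = cong 𝟙 (adj-sym G u w)

  nbrSum : (Fin n → ℕ) → Fin n → ℕ
  nbrSum x u = ∑[ w < n ] (edge u w * x w)

  nbrSum-zero : ∀ u → nbrSum (λ _ → 0) u ≡ 0
  nbrSum-zero u = trans (sum-cong-≗ (λ w → *-zeroʳ (edge u w))) (sum-replicate-zero n)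

  nbrSum-cong : ∀ {x y} → (∀ w → x w ≡ y w) → ∀ u → nbrSum x u ≡ nbrSum y u
  nbrSum-cong x≗y u = sum-cong-≗ (λ w → cong (edge u w *_) (x≗y w))

  nbrSum-+ : ∀ x y u → nbrSum (λ w → x w + y w) u ≡ nbrSum x u + nbrSum y u
  nbrSum-+ x y u = trans (sum-cong-≗ (λ w → *-distribˡ-+ (edge u w) (x w) (y w)))
                         (∑-distrib-+ (λ w → edge u w * x w) (λ w → edge u w * y w))

  nbrSum-* : ∀ k x u → nbrSum (λ w → k * x w) u ≡ k * nbrSum x u
  nbrSum-* k x u = trans (sum-cong-≗ (λ w → swap (edge u w) k (x w)))
                         (sym (*-distribˡ-sum k (λ w → edge u w * x w)))
    where
    swap : ∀ e k x → e * (k * x) ≡ k * (e * x)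
    swap = solve-∀

  nbrSum-unit : ∀ v u → nbrSum (unit v) u ≡ edge u v
  nbrSum-unit v u = trans (sum-cong-≗ (λ w → *-comm (edge u w) (unit v w))) (sum-unit v (edge u))

  degree≡nbrSum : ∀ u → degree G u ≡ nbrSum (λ _ → 1) u
  degree≡nbrSum u = trans (count≡sum (adj G u)) (sum-cong-≗ (λ w → sym (*-identityʳ (edge u w))))

  commonNbrs≡nbrSum : ∀ u z → commonNbrs G u z ≡ nbrSum (edge u) z
  commonNbrs≡nbrSum u z = trans (count≡sum (λ w → adj G u w ∧ adj G z w))
                                (sum-cong-≗ (λ w → 𝟙-∧ (adj G u w) (adj G z w)))

  commonNbrs-self : ∀ u → commonNbrs G u u ≡ degree G u
  commonNbrs-self u = trans (count≡sum (λ l → adj G u l ∧ adj G u l))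
    (trans (sum-cong-≗ (λ l → cong 𝟙 (∧-idem (adj G u l)))) (sym (count≡sum (adj G u))))

  nbrSum+self≤sum : ∀ x u → nbrSum x u + x u ≤ sum x
  nbrSum+self≤sum x u = begin
    nbrSum x u + x u
      ≡⟨ cong (nbrSum x u +_) (sum-unit u x) ⟨
    nbrSum x u + ∑[ w < n ] (unit u w * x w)
      ≡⟨ ∑-distrib-+ (λ w → edge u w * x w) (λ w → unit u w * x w) ⟨
    ∑[ w < n ] (edge u w * x w + unit u w * x w)
      ≤⟨ sum-mono atMostOnce ⟩
    sum x
      ∎
    where
    open ≤-Reasoning
    atMostOnce : ∀ w → edge u w * x w + unit u w * x w ≤ x w
    atMostOnce w with w ≟ u
    ... | yes refl rewrite irrefl G w = ≤-reflexive (+-identityʳ (x w))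
    ... | no _     rewrite *-zeroʳ (x w) | +-identityʳ (edge u w * x w) =
                   subst (edge u w * x w ≤_) (*-identityˡ (x w)) (*-monoˡ-≤ (x w) (𝟙≤1 (adj G u w)))

  nbrSum-symmetric : ∀ x y → ∑[ w < n ] (y w * nbrSum x w) ≡ ∑[ z < n ] (x z * nbrSum y z)
  nbrSum-symmetric x y = begin
    ∑[ w < n ] (y w * nbrSum x w)
      ≡⟨ sum-cong-≗ (λ w → *-distribˡ-sum (y w) (λ z → edge w z * x z)) ⟩
    ∑[ w < n ] ∑[ z < n ] (y w * (edge w z * x z))
      ≡⟨ ∑-comm (λ w z → y w * (edge w z * x z)) ⟩
    ∑[ z < n ] ∑[ w < n ] (y w * (edge w z * x z))
      ≡⟨ sum-cong-≗ (λ z → sum-cong-≗ (λ w → transpose w z)) ⟩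
    ∑[ z < n ] ∑[ w < n ] (x z * (edge z w * y w))
      ≡⟨ sum-cong-≗ (λ z → *-distribˡ-sum (x z) (λ w → edge z w * y w)) ⟨
    ∑[ z < n ] (x z * nbrSum y z)
      ∎
    where
    open ≡-Reasoning
    swap : ∀ y e x → y * (e * x) ≡ x * (e * y)
    swap = solve-∀
    transpose : ∀ w z → y w * (edge w z * x z) ≡ x z * (edge z w * y w)
    transpose w z rewrite edge-sym w z = swap (y w) (edge z w) (x z)

  handshake : ∀ x → ∑[ u < n ] nbrSum x u ≡ ∑[ z < n ] (degree G z * x z)
  handshake x = begin
    ∑[ u < n ] nbrSum x u                 ≡⟨ sum-cong-≗ (λ u → *-identityˡ (nbrSum x u)) ⟨
    ∑[ u < n ] (1 * nbrSum x u)           ≡⟨ nbrSum-symmetric x (λ _ → 1) ⟩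
    ∑[ z < n ] (x z * nbrSum (λ _ → 1) z) ≡⟨ sum-cong-≗ byDegree ⟩
    ∑[ z < n ] (degree G z * x z)         ∎
    where
    open ≡-Reasoning
    byDegree : ∀ z → x z * nbrSum (λ _ → 1) z ≡ degree G z * x z
    byDegree z = trans (*-comm (x z) _) (cong (_* x z) (sym (degree≡nbrSum z)))

  sharedNeighbour : ∀ {i z w} → T (adj G i w) → T (adj G z w) → 1 ≤ commonNbrs G i z
  sharedNeighbour {i} {z} {w} i∼w z∼w = begin
    1                        ≡⟨ cong₂ _*_ (T⇒𝟙≡1 z∼w) (T⇒𝟙≡1 i∼w) ⟨
    edge z w * edge i w      ≤⟨ term≤sum (λ l → edge z l * edge i l) w ⟩
    nbrSum (edge i) z        ≡⟨ commonNbrs≡nbrSum i z ⟨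
    commonNbrs G i z         ∎
    where open ≤-Reasoning

  private
    joinedTo? : ∀ i j → Dec (i ≢ j → T (adj G i j))
    joinedTo? i j = ¬? (i ≟ j) →-dec T? (adj G i j)

  nonEdge : ¬ Complete G → Σ (Fin n) λ i → Σ (Fin n) λ j → i ≢ j × ¬ T (adj G i j)
  nonEdge notComplete with ¬∀⟶∃¬ n _ (λ i → all? (joinedTo? i)) notComplete
  ... | i , ¬all with ¬∀⟶∃¬ n _ (joinedTo? i) ¬all
  ... | j , ¬joined = i , j , (λ i≡j → ¬joined (λ i≢j → ⊥-elim (i≢j i≡j)))
                           , (λ i∼j → ¬joined (λ _ → i∼j))

  -- On a walk leaving the closed neighbourhood of i, the first vertex outside it is a
  -- non-neighbour of i with a common neighbour (the vertex before it on the walk).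
  exitNeighbourhood : ∀ {i p j} → Walk G p j → p ≡ i ⊎ T (adj G i p) → j ≢ i → ¬ T (adj G i j) →
                      Σ (Fin n) λ z → i ≢ z × ¬ T (adj G i z) × 1 ≤ commonNbrs G i z
  exitNeighbourhood here (inj₁ j≡i) j≢i _ = ⊥-elim (j≢i j≡i)
  exitNeighbourhood here (inj₂ i∼j) _ i≁j = ⊥-elim (i≁j i∼j)
  exitNeighbourhood {i} (step {j = q} p∼q walk) start j≢i i≁j with q ≟ i | T? (adj G i q)
  ... | yes q≡i | _        = exitNeighbourhood walk (inj₁ q≡i) j≢i i≁j
  ... | no _    | yes i∼q  = exitNeighbourhood walk (inj₂ i∼q) j≢i i≁j
  ... | no q≢i  | no i≁q   = q , (λ i≡q → q≢i (sym i≡q)) , i≁q , common start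
    where
    common : _ ≡ i ⊎ T (adj G i _) → 1 ≤ commonNbrs G i q
    common (inj₁ refl) = ⊥-elim (i≁q p∼q)
    common (inj₂ i∼p)  = sharedNeighbour i∼p (subst T (adj-sym G _ q) p∼q)

  -- A vertex, its neighbours and a further non-neighbour are pairwise distinct vertices.
  degree+2≤n : ∀ {i j} → i ≢ j → ¬ T (adj G i j) → degree G i + 2 ≤ n
  degree+2≤n {i} {j} i≢j i≁j = begin
    degree G i + 2
      ≡⟨ cong₂ _+_ (count≡sum (adj G i)) (sym (cong₂ _+_ (sum-unit-1 i) (sum-unit-1 j))) ⟩
    ∑[ w < n ] edge i w + (∑[ w < n ] unit i w + ∑[ w < n ] unit j w)
      ≡⟨ cong (∑[ w < n ] edge i w +_) (∑-distrib-+ (unit i) (unit j)) ⟨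
    ∑[ w < n ] edge i w + ∑[ w < n ] (unit i w + unit j w)
      ≡⟨ ∑-distrib-+ (edge i) (λ w → unit i w + unit j w) ⟨
    ∑[ w < n ] (edge i w + (unit i w + unit j w))
      ≤⟨ sum-mono atMostOne ⟩
    ∑[ w < n ] 1
      ≡⟨ sum-ones n ⟩
    n
      ∎
    where
    open ≤-Reasoning
    atMostOne : ∀ w → edge i w + (unit i w + unit j w) ≤ 1
    atMostOne w with w ≟ i | w ≟ j
    ... | yes refl | yes w≡j = ⊥-elim (i≢j w≡j)
    ... | yes refl | no _    rewrite irrefl G w = ≤-refl
    ... | no _     | yes refl rewrite ¬T⇒𝟙≡0 i≁j = ≤-refl
    ... | no _     | no _     rewrite +-identityʳ (edge i w) = 𝟙≤1 (adj G i w)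

module ChipFiring {n : ℕ} (G : Graph n) where
  open import Data.Nat using (_+_)
  open FiniteSums
  open Graphs G

  firings : ∀ {a b s} → Game G a b s → Fin n → ℕ
  firings done          u = 0
  firings (fires v _ g) u = unit v u + firings g u

  sum-firings : ∀ {a b s} (g : Game G a b s) → sum (firings g) ≡ s
  sum-firings done          = sum-replicate-zero n
  sum-firings (fires v _ g) = trans (∑-distrib-+ (unit v) (firings g))
                                    (cong₂ _+_ (sum-unit-1 v) (sum-firings g))

  fire-balance : ∀ a v → CanFire G a v → ∀ u → fire G a v u + degree G u * unit v u ≡ a u + edge u v
  fire-balance a v canFire u with u ≟ v
  ... | yes refl rewrite irrefl G u | *-identityʳ (degree G u) =
    trans (m∸n+n≡m canFire) (sym (+-identityʳ (a u)))
  ... | no _ rewrite *-zeroʳ (degree G u) with adj G u v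
  ...   | true  = trans (+-identityʳ (suc (a u))) (sym (+-comm (a u) 1))
  ...   | false = refl

  balance : ∀ {a b s} (g : Game G a b s) u → b u + degree G u * firings g u ≡ a u + nbrSum (firings g) u
  balance {a} done u = begin
    a u + degree G u * 0        ≡⟨ cong₂ _+_ refl (trans (*-zeroʳ (degree G u)) (sym (nbrSum-zero u))) ⟩
    a u + nbrSum (λ _ → 0) u    ∎
    where open ≡-Reasoning
  balance {a} {b} (fires v canFire g) u = begin
    b u + d * (δ + x u)               ≡⟨ regroup (b u) d δ (x u) ⟩
    (b u + d * x u) + d * δ           ≡⟨ cong (_+ d * δ) (balance g u) ⟩
    (a′ u + nbrSum x u) + d * δ       ≡⟨ exchange (a′ u) (nbrSum x u) (d * δ) ⟩
    (a′ u + d * δ) + nbrSum x u       ≡⟨ cong (_+ nbrSum x u) (fire-balance a v canFire u) ⟩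
    (a u + edge u v) + nbrSum x u     ≡⟨ +-assoc (a u) (edge u v) (nbrSum x u) ⟩
    a u + (edge u v + nbrSum x u)     ≡⟨ cong (a u +_) (cong (_+ nbrSum x u) (nbrSum-unit v u)) ⟨
    a u + (nbrSum (unit v) u + nbrSum x u) ≡⟨ cong (a u +_) (nbrSum-+ (unit v) x u) ⟨
    a u + nbrSum (λ w → unit v w + x w) u ∎
    where
    open ≡-Reasoning
    x a′ : Fin n → ℕ
    x = firings g
    a′ = fire G a v
    d δ : ℕ
    d = degree G u
    δ = unit v u
    regroup : ∀ b d δ x → b + d * (δ + x) ≡ (b + d * x) + d * δ
    regroup = solve-∀
    exchange : ∀ p q r → (p + q) + r ≡ (p + r) + q
    exchange = solve-∀

  -- Chips are conserved: summing the balance over all vertices, sent and received chips cancel.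
  conservation : ∀ {a b s} → Game G a b s → sum b ≡ sum a
  conservation {a} {b} g = +-cancelʳ-≡ (∑[ u < n ] (degree G u * x u)) (sum b) (sum a) (begin
    sum b + ∑[ u < n ] (degree G u * x u)   ≡⟨ ∑-distrib-+ b (λ u → degree G u * x u) ⟨
    ∑[ u < n ] (b u + degree G u * x u)     ≡⟨ sum-cong-≗ (balance g) ⟩
    ∑[ u < n ] (a u + nbrSum x u)           ≡⟨ ∑-distrib-+ a (nbrSum x) ⟩
    sum a + ∑[ u < n ] nbrSum x u           ≡⟨ cong (sum a +_) (handshake x) ⟩
    sum a + ∑[ u < n ] (degree G u * x u)   ∎)
    where
    open ≡-Reasoning
    x : Fin n → ℕ
    x = firings g

  unfired-balance : ∀ {a b s} (g : Game G a b s) u → firings g u ≡ 0 → b u ≡ a u + nbrSum (firings g) u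
  unfired-balance {b = b} g u unfired = begin
    b u                             ≡⟨ +-identityʳ (b u) ⟨
    b u + 0                         ≡⟨ cong (b u +_) (*-zeroʳ (degree G u)) ⟨
    b u + degree G u * 0            ≡⟨ cong (λ t → b u + degree G u * t) unfired ⟨
    b u + degree G u * firings g u  ≡⟨ balance g u ⟩
    _                               ∎
    where open ≡-Reasoning

  degree≤nbrSum : ∀ x v → (∀ w → T (adj G v w) → 1 ≤ x w) → degree G v ≤ nbrSum x v
  degree≤nbrSum x v neighboursFire = begin
    degree G v          ≡⟨ degree≡nbrSum v ⟩
    nbrSum (λ _ → 1) v  ≤⟨ sum-mono receive ⟩
    nbrSum x v          ∎
    where
    open ≤-Reasoning
    receive : ∀ w → edge v w * 1 ≤ edge v w * x w
    receive w with T? (adj G v w)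
    ... | yes v∼w = *-monoʳ-≤ (edge v w) (neighboursFire w v∼w)
    ... | no  v≁w rewrite ¬T⇒𝟙≡0 v≁w = z≤n

  -- By induction on the game: if after the
  -- first firing (of v) some vertex never fires again, that vertex is v, every neighbour of v
  -- fires later, and v keeps the at least degree(v) chips it receives.
  everyoneFired⇒unstable : ∀ {a b s} (g : Game G a b s) → Fin n →
                           (∀ u → 1 ≤ firings g u) → ¬ Stable G b
  everyoneFired⇒unstable done u₀ allFire _ with allFire u₀
  ... | ()
  everyoneFired⇒unstable {b = b} (fires v canFire g) u₀ allFire stable with zeroOrPositive (firings g)
  ... | inj₂ allFireLater = everyoneFired⇒unstable g u₀ allFireLater stable
  ... | inj₁ (u , unfiredLater) with u ≟ v
  ...   | no u≢v = contradiction (subst (1 ≤_) lastFree (allFire u)) λ ()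
    where
    lastFree : unit v u + firings g u ≡ 0
    lastFree = cong₂ _+_ (unit-other u≢v) unfiredLater
  ...   | yes refl = <⇒≱ (stable u) (begin
    degree G u                          ≤⟨ degree≤nbrSum (firings g) u neighboursFireLater ⟩
    nbrSum (firings g) u                ≤⟨ m≤n+m (nbrSum (firings g) u) _ ⟩
    _ + nbrSum (firings g) u            ≡⟨ unfired-balance g u unfiredLater ⟨
    b u                                 ∎)
    where
    open ≤-Reasoning
    neighboursFireLater : ∀ w → T (adj G u w) → 1 ≤ firings g w
    neighboursFireLater w u∼w = subst (1 ≤_) (cong (_+ firings g w) (unit-other w≢u)) (allFire w)
      where
      w≢u : w ≢ u
      w≢u refl = subst T (irrefl G w) u∼w

  unfiredVertex : ∀ {a b s} (g : Game G a b s) → Stable G b → Fin n → Σ (Fin n) λ u → firings g u ≡ 0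
  unfiredVertex g stable u₀ with zeroOrPositive (firings g)
  ... | inj₁ unfired = unfired
  ... | inj₂ allFire = ⊥-elim (everyoneFired⇒unstable g u₀ allFire stable)

module StronglyRegular {n : ℕ} (G : Graph n) {k a c : ℕ} (srg : IsSRG n G k a c) where
  open import Data.Nat using (_+_)
  open FiniteSums
  open Graphs G
  open ChipFiring G

  regular : ∀ u → degree G u ≡ k
  regular = proj₁ srg

  μ-adjacent : ∀ u z → T (adj G u z) → commonNbrs G u z ≡ a
  μ-adjacent = proj₁ (proj₂ srg)

  μ-nonAdjacent : ∀ u z → u ≢ z → ¬ T (adj G u z) → commonNbrs G u z ≡ c
  μ-nonAdjacent = proj₂ (proj₂ srg)

  nbrSum-ones : ∀ u → nbrSum (λ _ → 1) u ≡ k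
  nbrSum-ones u = trans (sym (degree≡nbrSum u)) (regular u)

  -- Counting walks of length two from u: (A² x)(u) = Σ_z x z · μ(u, z), and μ(u, z) is k, a or c
  -- according as z is u, a neighbour of u, or a non-neighbour of u.
  twoStepCount : ∀ x u →
    nbrSum (nbrSum x) u + c * nbrSum x u + c * x u ≡ k * x u + a * nbrSum x u + c * sum x
  twoStepCount x u = begin
    nbrSum (nbrSum x) u + c * nbrSum x u + c * x u
      ≡⟨ cong₂ _+_ (cong (_+ c * nbrSum x u) walks) (cong (c *_) (sum-unit u x)) ⟨
    1 * ∑[ z < n ] (x z * μ z) + c * nbrSum x u + c * sum ux
      ≡⟨ sum-linear 1 c c (λ z → x z * μ z) ex ux ⟨
    ∑[ z < n ] (1 * (x z * μ z) + c * ex z + c * ux z)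
      ≡⟨ sum-cong-≗ byCases ⟩
    ∑[ z < n ] (k * ux z + a * ex z + c * x z)
      ≡⟨ sum-linear k a c ux ex x ⟩
    k * sum ux + a * nbrSum x u + c * sum x
      ≡⟨ cong (λ t → k * t + a * nbrSum x u + c * sum x) (sum-unit u x) ⟩
    k * x u + a * nbrSum x u + c * sum x
      ∎
    where
    open ≡-Reasoning
    μ : Fin n → ℕ
    μ z = commonNbrs G u z
    ex ux : Fin n → ℕ
    ex z = edge u z * x z
    ux z = unit u z * x z
    walks : 1 * ∑[ z < n ] (x z * μ z) ≡ nbrSum (nbrSum x) u
    walks = begin
      1 * ∑[ z < n ] (x z * μ z)                 ≡⟨ *-identityˡ _ ⟩
      ∑[ z < n ] (x z * μ z)                     ≡⟨ sum-cong-≗ (λ z → cong (x z *_) (commonNbrs≡nbrSum u z)) ⟩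
      ∑[ z < n ] (x z * nbrSum (edge u) z)       ≡⟨ nbrSum-symmetric x (edge u) ⟨
      nbrSum (nbrSum x) u                        ∎
    atSelf : ∀ x k a c → 1 * (x * k) + c * 0 + c * (1 * x) ≡ k * (1 * x) + a * 0 + c * x
    atSelf = solve-∀
    atNeighbour : ∀ x k a c → 1 * (x * a) + c * (1 * x) + c * 0 ≡ k * 0 + a * (1 * x) + c * x
    atNeighbour = solve-∀
    atOther : ∀ x k a c → 1 * (x * c) + c * 0 + c * 0 ≡ k * 0 + a * 0 + c * x
    atOther = solve-∀
    byCases : ∀ z → 1 * (x z * μ z) + c * ex z + c * ux z ≡ k * ux z + a * ex z + c * x z
    byCases z with z ≟ u | T? (adj G u z)
    ... | yes refl | _ rewrite irrefl G z | commonNbrs-self z | regular z = atSelf (x z) k a c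
    ... | no z≢u | yes u∼z rewrite T⇒𝟙≡1 u∼z | μ-adjacent u z u∼z = atNeighbour (x z) k a c
    ... | no z≢u | no u≁z rewrite ¬T⇒𝟙≡0 u≁z | μ-nonAdjacent u z (λ u≡z → z≢u (sym u≡z)) u≁z =
      atOther (x z) k a c

  -- The parameter relation k(k − a − 1) = c(n − k − 1): twoStepCount for the all-ones vector.
  parameterIdentity : Fin n → k * k + c * k + c ≡ k + a * k + c * n
  parameterIdentity u = begin
    k * k + c * k + c
      ≡⟨ cong₂ _+_ (cong₂ _+_ (sym secondLayer) (cong (c *_) (sym (nbrSum-ones u)))) (sym (*-identityʳ c)) ⟩
    nbrSum (nbrSum one) u + c * nbrSum one u + c * 1
      ≡⟨ twoStepCount one u ⟩
    k * 1 + a * nbrSum one u + c * sum one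
      ≡⟨ cong₂ _+_ (cong₂ _+_ (*-identityʳ k) (cong (a *_) (nbrSum-ones u))) (cong (c *_) (sum-ones n)) ⟩
    k + a * k + c * n
      ∎
    where
    open ≡-Reasoning
    one : Fin n → ℕ
    one _ = 1
    secondLayer : nbrSum (nbrSum one) u ≡ k * k
    secondLayer = begin
      nbrSum (nbrSum one) u   ≡⟨ nbrSum-cong (λ w → trans (nbrSum-ones w) (sym (*-identityʳ k))) u ⟩
      nbrSum (λ _ → k * 1) u  ≡⟨ nbrSum-* k one u ⟩
      k * nbrSum one u        ≡⟨ cong (k *_) (nbrSum-ones u) ⟩
      k * k                   ∎

  -- In a connected non-complete graph some vertex is at distance two from another, so c ≥ 1.
  c≥1 : Connected G → ¬ Complete G → 1 ≤ c
  c≥1 connected notComplete with nonEdge notComplete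
  ... | i , j , i≢j , i≁j
    with exitNeighbourhood (connected i j) (inj₁ refl) (λ j≡i → i≢j (sym j≡i)) i≁j
  ...   | z , i≢z , i≁z , shared = subst (1 ≤_) (μ-nonAdjacent i z i≢z i≁z) shared

  -- A vertex, its k neighbours and a non-neighbour.
  k+2≤n : ¬ Complete G → k + 2 ≤ n
  k+2≤n notComplete with nonEdge notComplete
  ... | i , j , i≢j , i≁j = subst (λ d → d + 2 ≤ n) (regular i) (degree+2≤n i≢j i≁j)

  -- Adjacent vertices share at most k − 2 neighbours unless the graph is complete: by the parameter
  -- relation, a = k − 1 would force n = k + 1.
  a+2≤k : Connected G → ¬ Complete G → a + 2 ≤ k
  a+2≤k connected notComplete with nonEdge notComplete
  ... | i , _ = subst (_≤ k) (sym (+-suc a 1)) (*-cancelʳ-< k (a + 1) k (begin-strict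
    (a + 1) * k              <⟨ m<m+n ((a + 1) * k) (c≥1 connected notComplete) ⟩
    (a + 1) * k + c          ≤⟨ +-cancelʳ-≤ (c * k + c) ((a + 1) * k + c) (k * k) squeezed ⟩
    k * k                    ∎))
    where
    open ≤-Reasoning
    expand : ∀ a k c → (a + 1) * k + c + (c * k + c) ≡ (a + 1) * k + c * (k + 2)
    expand = solve-∀
    regroup : ∀ a k c n → (a + 1) * k + c * n ≡ k + a * k + c * n
    regroup = solve-∀
    squeezed : (a + 1) * k + c + (c * k + c) ≤ k * k + (c * k + c)
    squeezed = begin
      (a + 1) * k + c + (c * k + c)   ≡⟨ expand a k c ⟩
      (a + 1) * k + c * (k + 2)       ≤⟨ +-monoʳ-≤ ((a + 1) * k) (*-monoʳ-≤ c (k+2≤n notComplete)) ⟩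
      (a + 1) * k + c * n             ≡⟨ regroup a k c n ⟩
      k + a * k + c * n               ≡⟨ parameterIdentity i ⟨
      k * k + c * k + c               ≡⟨ +-assoc (k * k) (c * k) c ⟩
      k * k + (c * k + c)             ∎

  -- The key inequality of the game at a vertex u that never fires, where X chips arrive from its
  -- neighbours: balancing the chips on the neighbourhood of u and counting two-step walks gives
  -- c·s + a·X ≤ (final chips on the neighbours of u) + (k + c)·X.
  unfiredVertexBound : ∀ {conf b s} (g : Game G conf b s) u → firings g u ≡ 0 →
                       c * s + a * nbrSum (firings g) u ≤ nbrSum b u + (k + c) * nbrSum (firings g) u
  unfiredVertexBound {conf} {b} {s} g u unfired = begin
    c * s + a * X                  ≤⟨ m≤m+n (c * s + a * X) A ⟩
    c * s + a * X + A              ≡⟨ reorder₁ k a c s X A ⟩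
    (k * 0 + a * X + c * s) + A    ≡⟨ cong (_+ A) twoStep ⟨
    (W + c * X + c * 0) + A        ≡⟨ reorder₂ W c X A ⟩
    (A + W) + c * X                ≡⟨ cong (_+ c * X) neighbourBalance ⟨
    (B + k * X) + c * X            ≡⟨ reorder₃ B k X c ⟩
    B + (k + c) * X                ∎
    where
    open ≤-Reasoning
    x : Fin n → ℕ
    x = firings g
    X A B W : ℕ
    X = nbrSum x u
    A = nbrSum conf u
    B = nbrSum b u
    W = nbrSum (nbrSum x) u
    twoStep : W + c * X + c * 0 ≡ k * 0 + a * X + c * s
    twoStep = begin-equality
      W + c * X + c * 0            ≡⟨ cong (λ t → W + c * X + c * t) unfired ⟨
      W + c * X + c * x u          ≡⟨ twoStepCount x u ⟩
      k * x u + a * X + c * sum x  ≡⟨ cong₂ (λ t r → k * t + a * X + c * r) unfired (sum-firings g) ⟩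
      k * 0 + a * X + c * s        ∎
    neighbourBalance : B + k * X ≡ A + W
    neighbourBalance = begin-equality
      B + k * X                                   ≡⟨ cong (B +_) (nbrSum-* k x u) ⟨
      B + nbrSum (λ w → k * x w) u                ≡⟨ cong (B +_) (nbrSum-cong (cong (_* x _) ∘ regular) u) ⟨
      B + nbrSum (λ w → degree G w * x w) u       ≡⟨ nbrSum-+ b (λ w → degree G w * x w) u ⟨
      nbrSum (λ w → b w + degree G w * x w) u     ≡⟨ nbrSum-cong (balance g) u ⟩
      nbrSum (λ w → conf w + nbrSum x w) u        ≡⟨ nbrSum-+ conf (nbrSum x) u ⟩
      A + W                                       ∎
    reorder₁ : ∀ k a c s X A → c * s + a * X + A ≡ (k * 0 + a * X + c * s) + A
    reorder₁ = solve-∀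
    reorder₂ : ∀ W c X A → (W + c * X + c * 0) + A ≡ (A + W) + c * X
    reorder₂ = solve-∀
    reorder₃ : ∀ B k X c → (B + k * X) + c * X ≡ B + (k + c) * X
    reorder₃ = solve-∀

module Arithmetic where
  open import Data.Nat using (_+_)

  -- The parameter relation for k = a + p + 2 (so p = k − 2 − a ≥ 0) gives (p + c + 1)(k − 2) ≤ nc.
  parameterBound : ∀ {m a p c n} → a + p ≡ m →
                   (2 + m) * (2 + m) + c * (2 + m) + c ≡ (2 + m) + a * (2 + m) + c * n →
                   (p + c + 1) * m ≤ n * c
  parameterBound {a = a} {p} {c} {n} refl identity = subst (_≤ n * c) (*-comm m (p + c + 1))
    (+-cancelʳ-≤ (k + a * k) (m * (p + c + 1)) (n * c) (begin
      m * (p + c + 1) + (k + a * k)                        ≤⟨ m≤m+n _ (2 * p + 2 + 3 * c) ⟩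
      m * (p + c + 1) + (k + a * k) + (2 * p + 2 + 3 * c)  ≡⟨ expand a p c ⟩
      k * k + c * k + c                                    ≡⟨ identity ⟩
      k + a * k + c * n                                    ≡⟨ regroup k a c n ⟩
      n * c + (k + a * k)                                  ∎))
    where
    open ≤-Reasoning
    m k : ℕ
    m = a + p
    k = 2 + m
    expand : ∀ a p c → (a + p) * (p + c + 1) + ((2 + (a + p)) + a * (2 + (a + p))) + (2 * p + 2 + 3 * c)
                     ≡ (2 + (a + p)) * (2 + (a + p)) + c * (2 + (a + p)) + c
    expand = solve-∀
    regroup : ∀ k a c n → k + a * k + c * n ≡ n * c + (k + a * k)
    regroup = solve-∀

  -- The inequality of the theorem with denominators cleared, for k = m + 2:
  -- s·m·c + 2(m + 1)m ≤ n(m + 1)c + 4Nm, from the bound at an unfired vertex (X ≤ k − 1 chips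
  -- received, B chips on its neighbours, B + X ≤ N) and the parameter relation.
  clearedBound : ∀ {m a c n s X B N} → 1 ≤ c → a + 2 ≤ 2 + m →
                 (2 + m) * (2 + m) + c * (2 + m) + c ≡ (2 + m) + a * (2 + m) + c * n →
                 c * s + a * X ≤ B + (2 + m + c) * X → X < 2 + m → B + X ≤ N →
                 s * m * c + 2 * suc m * m ≤ n * suc m * c + 4 * N * m
  clearedBound {m} {a} {c} {n} {s} {X} {B} {N} c≥1 a+2≤k identity atUnfired X<k B+X≤N
    with m≤n⇒∃[o]m+o≡n (+-cancelʳ-≤ 2 a m (subst (a + 2 ≤_) (+-comm 2 m) a+2≤k))
       | m≤n⇒∃[o]m+o≡n (≤-pred X<k)
  ... | p , a+p≡m | d , X+d≡m+1 = begin
    s * m * c + 2 * suc m * m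
      ≡⟨ e₁ s m c ⟩
    m * (c * s) + 2 * m * suc m
      ≡⟨ cong (λ t → m * (c * s) + 2 * m * t) X+d≡m+1 ⟨
    m * (c * s) + 2 * m * (X + d)
      ≤⟨ +-monoˡ-≤ (2 * m * (X + d)) (*-monoʳ-≤ m cs≤) ⟩
    m * (B + (p + 2 + c) * X) + 2 * m * (X + d)
      ≡⟨ e₂ m B p c X d ⟩
    m * B + 4 * m * X + ((p + c) * m * X + 2 * m * d)
      ≤⟨ +-mono-≤ (+-monoˡ-≤ (4 * m * X) (*-monoˡ-≤ B (m≤n*m m 4))) spread ⟩
    4 * m * B + 4 * m * X + (q * m * X + q * m * d)
      ≡⟨ e₃ m B X q d ⟩
    4 * m * (B + X) + q * m * (X + d)
      ≡⟨ cong (λ t → 4 * m * (B + X) + q * m * t) X+d≡m+1 ⟩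
    4 * m * (B + X) + q * m * suc m
      ≤⟨ +-mono-≤ (*-monoʳ-≤ (4 * m) B+X≤N) (*-monoˡ-≤ (suc m) (parameterBound {a = a} {p} a+p≡m identity)) ⟩
    4 * m * N + n * c * suc m
      ≡⟨ e₄ m N n c ⟩
    n * suc m * c + 4 * N * m
      ∎
    where
    open ≤-Reasoning
    q : ℕ
    q = p + c + 1
    -- with k = a + (p + 2) the a·X terms cancel from the bound at the unfired vertex
    cs≤ : c * s ≤ B + (p + 2 + c) * X
    cs≤ = +-cancelˡ-≤ (a * X) (c * s) (B + (p + 2 + c) * X) (begin
      a * X + c * s                     ≡⟨ +-comm (a * X) (c * s) ⟩
      c * s + a * X                     ≤⟨ atUnfired ⟩
      B + (2 + m + c) * X               ≡⟨ cong (λ t → B + (2 + t + c) * X) a+p≡m ⟨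
      B + (2 + (a + p) + c) * X         ≡⟨ split a p B c X ⟩
      a * X + (B + (p + 2 + c) * X)     ∎)
      where
      split : ∀ a p B c X → B + (2 + (a + p) + c) * X ≡ a * X + (B + (p + 2 + c) * X)
      split = solve-∀
    -- q ≥ p + c and q ≥ 2 (as c ≥ 1)
    spread : (p + c) * m * X + 2 * m * d ≤ q * m * X + q * m * d
    spread = +-mono-≤ (*-monoˡ-≤ X (*-monoˡ-≤ m (m≤m+n (p + c) 1)))
                      (*-monoˡ-≤ d (*-monoˡ-≤ m (+-monoˡ-≤ 1 (≤-trans c≥1 (m≤n+m c p)))))
    e₁ : ∀ s m c → s * m * c + 2 * suc m * m ≡ m * (c * s) + 2 * m * suc m
    e₁ = solve-∀
    e₂ : ∀ m B p c X d → m * (B + (p + 2 + c) * X) + 2 * m * (X + d)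
                       ≡ m * B + 4 * m * X + ((p + c) * m * X + 2 * m * d)
    e₂ = solve-∀
    e₃ : ∀ m B X q d → 4 * m * B + 4 * m * X + (q * m * X + q * m * d)
                     ≡ 4 * m * (B + X) + q * m * (X + d)
    e₃ = solve-∀
    e₄ : ∀ m N n c → 4 * m * N + n * c * suc m ≡ n * suc m * c + 4 * N * m
    e₄ = solve-∀

open import Data.Integer using (ℤ; +_; _+_; _-_) renaming (_*_ to _*ℤ_; _≤_ to _≤ℤ_)
open import Data.Integer using (-_; +≤+)
import Data.Integer.Properties as ℤ
open import Data.Integer.Tactic.RingSolver as ℤ-Solver using ()
import Data.Nat as ℕ

ℕ-bound⇒ℤ-bound : ∀ L D T → L ℕ.+ D ≤ T → + L ≤ℤ + T - + D
ℕ-bound⇒ℤ-bound L D T L+D≤T = begin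
  + L                  ≡⟨ cancel (+ L) (+ D) ⟨
  + L + + D - + D      ≡⟨ cong (_- + D) (ℤ.pos-+ L D) ⟨
  + (L ℕ.+ D) - + D    ≤⟨ ℤ.+-monoˡ-≤ (- + D) (+≤+ L+D≤T) ⟩
  + T - + D            ∎
  where
  open ℤ.≤-Reasoning
  cancel : ∀ x y → x + y - y ≡ x
  cancel = ℤ-Solver.solve-∀

integerForm : ∀ R N m →
  + (R ℕ.+ 4 * N * m) - + (2 * suc m * m) ≡ + R + (+ 2 *ℤ ((+ (2 * N) - + suc (suc m)) + + 1)) *ℤ + m
integerForm R N m = begin
  + (R ℕ.+ 4 * N * m) - + (2 * suc m * m)
    ≡⟨ cong₂ _-_ cast₁ cast₂ ⟩
  + R + + 4 *ℤ + N *ℤ + m - + 2 *ℤ (+ 1 + + m) *ℤ + m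
    ≡⟨ rearrange (+ R) (+ N) (+ m) ⟩
  + R + (+ 2 *ℤ ((+ 2 *ℤ + N - (+ 2 + + m)) + + 1)) *ℤ + m
    ≡⟨ cong₂ (λ t u → + R + (+ 2 *ℤ ((t - u) + + 1)) *ℤ + m) (ℤ.pos-* 2 N) (ℤ.pos-+ 2 m) ⟨
  + R + (+ 2 *ℤ ((+ (2 * N) - + suc (suc m)) + + 1)) *ℤ + m
    ∎
  where
  open ≡-Reasoning
  cast₁ : + (R ℕ.+ 4 * N * m) ≡ + R + + 4 *ℤ + N *ℤ + m
  cast₁ = trans (ℤ.pos-+ R (4 * N * m))
                (cong (λ t → + R + t) (trans (ℤ.pos-* (4 * N) m) (cong (_*ℤ + m) (ℤ.pos-* 4 N))))
  cast₂ : + (2 * suc m * m) ≡ + 2 *ℤ (+ 1 + + m) *ℤ + m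
  cast₂ = trans (ℤ.pos-* (2 * suc m) m)
                (cong (_*ℤ + m) (trans (ℤ.pos-* 2 (suc m)) (cong (+ 2 *ℤ_) (ℤ.pos-+ 1 m))))
  rearrange : ∀ R N m → R + + 4 *ℤ N *ℤ m - + 2 *ℤ (+ 1 + m) *ℤ m
                      ≡ R + (+ 2 *ℤ ((+ 2 *ℤ N - (+ 2 + m)) + + 1)) *ℤ m
  rearrange = ℤ-Solver.solve-∀

mainTheorem10 : (n k a c : ℕ) (G : Graph n) → IsSRG n G k a c → Connected G → ¬ Complete G → 3 ≤ k →
                  (conf : Config n) (N s : ℕ) → total conf ≡ N → TerminatingGame G conf s →
                  + (s * (k ∸ 2) * c) ≤ℤ + (n * (k ∸ 1) * c) + (+ 2 *ℤ ((+ (2 * N) - + k) + + 1)) *ℤ + (k ∸ 2)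
mainTheorem10 n (suc zero) a c G srg connected notComplete (s≤s ())
mainTheorem10 n (suc (suc m)) a c G srg connected notComplete _ conf .(total conf) s refl (b , game , stable) =
  begin
    + (s * m * c)
      ≤⟨ ℕ-bound⇒ℤ-bound _ _ _ cleared ⟩
    + (n * suc m * c ℕ.+ 4 * total conf * m) - + (2 * suc m * m)
      ≡⟨ integerForm (n * suc m * c) (total conf) m ⟩
    + (n * suc m * c) + (+ 2 *ℤ ((+ (2 * total conf) - + suc (suc m)) + + 1)) *ℤ + m
      ∎
  where
  open ℤ.≤-Reasoning
  open FiniteSums using (total≡sum)
  open Graphs G using (nonEdge; nbrSum; nbrSum+self≤sum)
  open ChipFiring G using (firings; unfiredVertex; unfired-balance; conservation)
  open StronglyRegular G srg using (c≥1; a+2≤k; parameterIdentity; unfiredVertexBound; regular)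
  vertex u : Fin n
  vertex = proj₁ (nonEdge notComplete)
  u = proj₁ (unfiredVertex game stable vertex)
  unfired : firings game u ≡ 0
  unfired = proj₂ (unfiredVertex game stable vertex)
  X : ℕ
  X = nbrSum (firings game) u
  -- the chips received by u stay there, and u ends with fewer than k chips
  X≤bu : X ≤ b u
  X≤bu = ≤-trans (m≤n+m X (conf u)) (≤-reflexive (sym (unfired-balance game u unfired)))
  X<k : X < suc (suc m)
  X<k = ≤-trans (s≤s X≤bu) (subst (suc (b u) ≤_) (regular u) (stable u))
  -- the final chips on the closed neighbourhood of u are among all chips, which are conserved
  B+X≤N : nbrSum b u ℕ.+ X ≤ total conf
  B+X≤N = ≤-trans (+-monoʳ-≤ (nbrSum b u) X≤bu)
                  (subst (nbrSum b u ℕ.+ b u ≤_) (trans (conservation game) (sym (total≡sum conf)))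
                         (nbrSum+self≤sum b u))
  cleared : s * m * c ℕ.+ 2 * suc m * m ≤ n * suc m * c ℕ.+ 4 * total conf * m
  cleared = Arithmetic.clearedBound (c≥1 connected notComplete) (a+2≤k connected notComplete)
              (parameterIdentity vertex) (unfiredVertexBound game u unfired) X<k B+X≤N
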